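{- Let $\alpha:\omega\to\omega$ be a computable function. Then the map $\alpha^*:\mathcal{M}_\omega\to\mathcal{M}_\omega$, $(\alpha^*((\mathcal{A}_i)_{i\in\omega}))_n=\mathcal{A}_{\alpha(n)}$, has a right adjoint $\exists_\alpha$ and a left adjoint $\forall_\alpha$; that is, there are order-preserving maps $\exists_\alpha,\forall_\alpha:\mathcal{M}_\omega\to\mathcal{M}_\omega$ such that for all $X,Y\in\mathcal{M}_\omega$: $\alpha^*(X)\le Y$ iff $X\le\exists_\alpha(Y)$, and $X\le\alpha^*(Y)$ iff $\forall_\alpha(X)\le Y$.
   Context: An $\omega$-mass problem is a sequence $(\mathcal{A}_i)_{i\in\omega}$ of subsets of $\omega^\omega$. $(\mathcal{A}_i)\le_{\mathcal{M}_\omega}(\mathcal{B}_i)$ iff a single partial Turing functional $\Phi$ has $\Phi(n^\frown\mathcal{B}_n)\subseteq\mathcal{A}_n$ for all $n$, where $n^\frown f$ is the function with first value $n$ followed by $f$. $\mathcal{M}_\omega$ is the partially ordered set of the resulting degrees, and $\alpha^*$ is well defined on degrees for computable $\alpha$. -}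

module Defs where

open import Data.Nat using (ℕ; zero; suc; _<_)
open import Data.Fin using (Fin)
open import Data.Vec using (Vec; []; _∷_; lookup)
open import Data.Product using (Σ; _×_)
open import Relation.Binary.PropositionalEquality using (_≡_)

-- A code of arity k denotes a partial function ℕ^k ⇀ ℕ relative to an
-- oracle f : ℕ → ℕ.  Partial Turing functionals on ω^ω are exactly the
-- unary codes: Φ_e(f)(x) = Eval e f [x], Φ_e(f) defined iff total.

data Code : ℕ → Set where
  cZ    : ∀ {k} → Code k
  cS    : Code 1
  cP    : ∀ {k} → Fin k → Code k
  cO    : Code 1
  cComp : ∀ {k m} → Code m → Vec (Code k) m → Code k
  cRec  : ∀ {k} → Code k → Code (suc (suc k)) → Code (suc k)
  cMin  : ∀ {k} → Code (suc k) → Code k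

mutual
  data Eval : ∀ {k} → Code k → (ℕ → ℕ) → Vec ℕ k → ℕ → Set where
    eZ    : ∀ {k f} {xs : Vec ℕ k} → Eval cZ f xs 0
    eS    : ∀ {f x} → Eval cS f (x ∷ []) (suc x)
    eP    : ∀ {k f} {xs : Vec ℕ k} (i : Fin k) → Eval (cP i) f xs (lookup xs i)
    eO    : ∀ {f x} → Eval cO f (x ∷ []) (f x)
    eComp : ∀ {k m f} {g : Code m} {hs : Vec (Code k) m} {xs : Vec ℕ k}
              {ys : Vec ℕ m} {y : ℕ} →
            EvalVec hs f xs ys → Eval g f ys y → Eval (cComp g hs) f xs y
    eRec0 : ∀ {k f} {g : Code k} {h : Code (suc (suc k))} {xs : Vec ℕ k} {y : ℕ} →
            Eval g f xs y → Eval (cRec g h) f (0 ∷ xs) y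
    eRecS : ∀ {k f} {g : Code k} {h : Code (suc (suc k))} {xs : Vec ℕ k}
              {n r y : ℕ} →
            Eval (cRec g h) f (n ∷ xs) r → Eval h f (n ∷ r ∷ xs) y →
            Eval (cRec g h) f (suc n ∷ xs) y
    eMin  : ∀ {k f} {g : Code (suc k)} {xs : Vec ℕ k} {y : ℕ} →
            Eval g f (y ∷ xs) 0 →
            (∀ z → z < y → Σ ℕ (λ m → Eval g f (z ∷ xs) (suc m))) →
            Eval (cMin g) f xs y

  data EvalVec : ∀ {k m} → Vec (Code k) m → (ℕ → ℕ) → Vec ℕ k → Vec ℕ m → Set where
    ev[] : ∀ {k f} {xs : Vec ℕ k} → EvalVec [] f xs []
    ev∷  : ∀ {k m f} {h : Code k} {hs : Vec (Code k) m} {xs : Vec ℕ k} {y : ℕ}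
             {ys : Vec ℕ m} →
           Eval h f xs y → EvalVec hs f xs ys → EvalVec (h ∷ hs) f xs (y ∷ ys)

_⟦_⟧≡_ : Code 1 → (ℕ → ℕ) → (ℕ → ℕ) → Set
e ⟦ f ⟧≡ g = ∀ x → Eval e f (x ∷ []) (g x)

Computable : (ℕ → ℕ) → Set
Computable α = Σ (Code 1) (λ e → e ⟦ (λ _ → 0) ⟧≡ α)

Subset : Set₁
Subset = (ℕ → ℕ) → Set

MassProblem : Set₁
MassProblem = ℕ → Subset

_⁀_ : ℕ → (ℕ → ℕ) → (ℕ → ℕ)
(n ⁀ f) zero    = n
(n ⁀ f) (suc x) = f x

_≤ω_ : MassProblem → MassProblem → Set
A ≤ω B = Σ (Code 1) (λ Φ → ∀ n f → B n f →
           Σ (ℕ → ℕ) (λ g → (Φ ⟦ n ⁀ f ⟧≡ g) × A n g))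

_* : (ℕ → ℕ) → MassProblem → MassProblem
(α *) A n = A (α n)

-- ∃α Y consists, at index m, of the functions n ⁀ g with α n = m and g ∈ Yₙ; ∀α X consists, at
-- index m, of the functions h that encode, through Cantor pairing, one element of Xₙ for every n
-- with α n = m.  All four transpositions are then realised by a single functional, because α is
-- computable, the index m is the head of the oracle, and equality of indices is decidable by a
-- primitive recursive test: the functional can read off n from the oracle, compute α n, and
-- recover or assemble the relevant members of the family uniformly in m.

module Submission where

open import Defs
open import Data.Nat using (ℕ; zero; suc; _+_; _∸_; _≤_; _<_; pred; z≤n; s≤s; _≟_)
open import Data.Nat.Properties
open import Data.Fin using (Fin; #_; _↑ˡ_; _↑ʳ_)
open import Data.Vec using (Vec; []; _∷_; _++_; lookup)
open import Data.Vec.Properties using (lookup-++ˡ; lookup-++ʳ)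
open import Data.Product using (Σ; _×_; _,_; proj₁; proj₂)
open import Relation.Binary.Definitions using (tri<; tri≈; tri>)
open import Function using (_∘_)
open import Relation.Nullary using (Dec; yes; no; contradiction)
open import Relation.Binary.PropositionalEquality

private
  variable
    k : ℕ
    f : ℕ → ℕ
    xs : Vec ℕ k

eval-cP : ∀ (i : Fin k) {y} → lookup xs i ≡ y → Eval (cP i) f xs y
eval-cP i refl = eP i

eval₁ : ∀ {g : Code 1} {h : Code k} {y z} →
        Eval h f xs y → Eval g f (y ∷ []) z → Eval (cComp g (h ∷ [])) f xs z
eval₁ e = eComp (ev∷ e ev[])

eval₂ : ∀ {g : Code 2} {h₁ h₂ : Code k} {y₁ y₂ z} →
        Eval h₁ f xs y₁ → Eval h₂ f xs y₂ → Eval g f (y₁ ∷ y₂ ∷ []) z →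
        Eval (cComp g (h₁ ∷ h₂ ∷ [])) f xs z
eval₂ e₁ e₂ = eComp (ev∷ e₁ (ev∷ e₂ ev[]))

eval-cRec : ∀ {g : Code k} {h : Code (suc (suc k))} (t : ℕ → ℕ) →
            Eval g f xs (t 0) → (∀ u → Eval h f (u ∷ t u ∷ xs) (t (suc u))) →
            ∀ u → Eval (cRec g h) f (u ∷ xs) (t u)
eval-cRec t e₀ step zero    = eRec0 e₀
eval-cRec t e₀ step (suc u) = eRecS (eval-cRec t e₀ step u) (step u)

IsLeastZero : (ℕ → ℕ) → ℕ → Set
IsLeastZero v y = v y ≡ 0 × (∀ z → z < y → Σ ℕ λ m → v z ≡ suc m)

leastZero : ∀ (v : ℕ → ℕ) b → v b ≡ 0 → Σ ℕ (IsLeastZero v)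
leastZero v zero    vb≡0 = 0 , vb≡0 , λ _ ()
leastZero v (suc b) vb≡0 with v 0 in v0≡
... | zero  = 0 , v0≡ , λ _ ()
... | suc m with leastZero (v ∘ suc) b vb≡0
...   | y , vy≡0 , below = suc y , vy≡0 , λ where
          zero    _         → m , v0≡
          (suc z) (s≤s z<y) → below z z<y

isLeastZero-unique : ∀ {v y y′} → IsLeastZero v y → IsLeastZero v y′ → y ≡ y′
isLeastZero-unique {y = y} {y′} (vy≡0 , below) (vy′≡0 , below′) with <-cmp y y′
... | tri< y<y′ _ _ with () ← trans (sym vy≡0) (proj₂ (below′ y y<y′))
... | tri≈ _ y≡y′ _ = y≡y′
... | tri> _ _ y′<y with () ← trans (sym vy′≡0) (proj₂ (below y′ y′<y))

eval-cMin : ∀ {g : Code (suc k)} {v : ℕ → ℕ} {y} →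
            (∀ s → Eval g f (s ∷ xs) (v s)) → IsLeastZero v y → Eval (cMin g) f xs y
eval-cMin {f = f} {xs = xs} {g = g} eval-g (vy≡0 , below) =
  eMin (subst (Eval g f (_ ∷ xs)) vy≡0 (eval-g _))
       (λ z z<y → proj₁ (below z z<y) ,
                  subst (Eval g f (z ∷ xs)) (proj₂ (below z z<y)) (eval-g z))

-- relativize T c answers each oracle query of c with T, which also reads a trailing parameter.

mutual
  relativize : Code 2 → Code k → Code (k + 1)
  relativize T cZ               = cZ
  relativize T cS               = cComp cS (cP (# 0) ∷ [])
  relativize T (cP i)           = cP (i ↑ˡ 1)
  relativize T cO               = T
  relativize T (cComp {k} g hs) = cComp (relativize T g) (relativizeAll T hs ++ cP (k ↑ʳ # 0) ∷ [])
  relativize T (cRec g h)       = cRec (relativize T g) (relativize T h)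
  relativize T (cMin g)         = cMin (relativize T g)

  relativizeAll : ∀ {m} → Code 2 → Vec (Code k) m → Vec (Code (k + 1)) m
  relativizeAll T []       = []
  relativizeAll T (c ∷ cs) = relativize T c ∷ relativizeAll T cs

module _ {T : Code 2} {f g : ℕ → ℕ} {p : ℕ} (T-computes : ∀ u → Eval T f (u ∷ p ∷ []) (g u)) where

  mutual
    eval-relativize : ∀ {c : Code k} {y} → Eval c g xs y → Eval (relativize T c) f (xs ++ p ∷ []) y
    eval-relativize eZ               = eZ
    eval-relativize eS               = eval₁ (eP (# 0)) eS
    eval-relativize (eP {xs = xs} i) = eval-cP (i ↑ˡ 1) (lookup-++ˡ xs (p ∷ []) i)
    eval-relativize (eO {x = x})     = T-computes x
    eval-relativize (eComp es e)     = eComp (eval-relativizeAll es) (eval-relativize e)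
    eval-relativize (eRec0 e)        = eRec0 (eval-relativize e)
    eval-relativize (eRecS e₁ e₂)    = eRecS (eval-relativize e₁) (eval-relativize e₂)
    eval-relativize (eMin e below)   =
      eMin (eval-relativize e) (λ z z<y → proj₁ (below z z<y) , eval-relativize (proj₂ (below z z<y)))

    eval-relativizeAll : ∀ {m} {hs : Vec (Code k) m} {ys} → EvalVec hs g xs ys →
                         EvalVec (relativizeAll T hs ++ cP (k ↑ʳ # 0) ∷ []) f (xs ++ p ∷ []) (ys ++ p ∷ [])
    eval-relativizeAll {k} {xs = xs} ev[] = ev∷ (eval-cP (k ↑ʳ # 0) (lookup-++ʳ xs (p ∷ []) (# 0))) ev[]
    eval-relativizeAll (ev∷ e es)         = ev∷ (eval-relativize e) (eval-relativizeAll es)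

withOracle : Code 1 → Code 1 → Code 1
withOracle T c = cComp (relativize (cComp T (cP (# 0) ∷ [])) c) (cP (# 0) ∷ cZ ∷ [])

eval-withOracle : ∀ {T c : Code 1} {g : ℕ → ℕ} {x y} →
                  T ⟦ f ⟧≡ g → Eval c g (x ∷ []) y → Eval (withOracle T c) f (x ∷ []) y
eval-withOracle T-computes e =
  eval₂ (eP (# 0)) eZ (eval-relativize (λ u → eval₁ (eP (# 0)) (T-computes u)) e)

headC : Code k
headC = cComp cO (cZ ∷ [])

eval-headC : Eval (headC {k}) f xs (f 0)
eval-headC = eval₁ eZ eO

tailC : Code 1
tailC = cComp cO (cComp cS (cP (# 0) ∷ []) ∷ [])

eval-tailC : ∀ {x} → Eval tailC f (x ∷ []) (f (suc x))
eval-tailC = eval₁ (eval₁ (eP (# 0)) eS) eO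

consC : Code k → Code 1 → Code (suc k)
consC c t = cRec c (cComp t (cP (# 0) ∷ []))

consC-computes : ∀ {c : Code k} {t : Code 1} {a} {g : ℕ → ℕ} →
                 Eval c f xs a → t ⟦ f ⟧≡ g → ∀ u → Eval (consC c t) f (u ∷ xs) ((a ⁀ g) u)
consC-computes {a = a} {g} e t-computes = eval-cRec (a ⁀ g) e (λ u → eval₁ (eP (# 0)) (t-computes u))

-- guardC b c is 0 where b is 0 and c where b is 1; recursing on b keeps c from being run when b is 0.
guardC : Code 1 → Code 1 → Code 1
guardC b c = cComp (cRec cZ (cComp c (cP (# 2) ∷ []))) (b ∷ cP (# 0) ∷ [])

eval-guardC-0 : ∀ {b c : Code 1} {z} → Eval b f (z ∷ []) 0 → Eval (guardC b c) f (z ∷ []) 0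
eval-guardC-0 eb = eval₂ eb (eP (# 0)) (eRec0 eZ)

eval-guardC-1 : ∀ {b c : Code 1} {z y} →
                Eval b f (z ∷ []) 1 → Eval c f (z ∷ []) y → Eval (guardC b c) f (z ∷ []) y
eval-guardC-1 eb ec = eval₂ eb (eP (# 0)) (eRecS (eRec0 eZ) (eval₁ (eP (# 2)) ec))

predC : Code 1
predC = cRec cZ (cP (# 0))

eval-predC : ∀ n → Eval predC f (n ∷ []) (pred n)
eval-predC = eval-cRec pred eZ (λ u → eP (# 0))

∸C : Code 2
∸C = cComp (cRec (cP (# 0)) (cComp predC (cP (# 1) ∷ []))) (cP (# 1) ∷ cP (# 0) ∷ [])

eval-∸C : ∀ a b → Eval ∸C f (a ∷ b ∷ []) (a ∸ b)
eval-∸C a b = eval₂ (eP (# 1)) (eP (# 0)) (eval-cRec (a ∸_) (eP (# 0)) step b)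
  where
  step : ∀ u → Eval (cComp predC (cP (# 1) ∷ [])) _ (u ∷ a ∸ u ∷ a ∷ []) (a ∸ suc u)
  step u = subst (Eval _ _ _) (pred[m∸n]≡m∸[1+n] a u) (eval₁ (eP (# 1)) (eval-predC (a ∸ u)))

+C : Code 2
+C = cRec (cP (# 0)) (cComp cS (cP (# 1) ∷ []))

eval-+C : ∀ a b → Eval +C f (a ∷ b ∷ []) (a + b)
eval-+C a b = eval-cRec (_+ b) (eP (# 0)) (λ u → eval₁ (eP (# 1)) eS) a

isEq : ℕ → ℕ → ℕ
isEq a b = 1 ∸ ((a ∸ b) + (b ∸ a))

isEq-refl : ∀ a → isEq a a ≡ 1
isEq-refl a = cong (λ d → 1 ∸ (d + d)) (n∸n≡0 a)

isEq-≢ : ∀ {a b} → a ≢ b → isEq a b ≡ 0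
isEq-≢ {a} {b} a≢b with (a ∸ b) + (b ∸ a) in eq
... | suc d = 0∸n≡0 d
... | zero  = contradiction (≤-antisym (m∸n≡0⇒m≤n (m+n≡0⇒m≡0 (a ∸ b) eq))
                                       (m∸n≡0⇒m≤n (m+n≡0⇒n≡0 (a ∸ b) eq))) a≢b

isEqC : Code 2
isEqC = cComp ∸C (cComp cS (cZ ∷ []) ∷ cComp +C (∸C ∷ cComp ∸C (cP (# 1) ∷ cP (# 0) ∷ []) ∷ []) ∷ [])

eval-isEqC : ∀ a b → Eval isEqC f (a ∷ b ∷ []) (isEq a b)
eval-isEqC a b =
  eval₂ (eval₁ eZ eS) (eval₂ (eval-∸C a b) (eval₂ (eP (# 1)) (eP (# 0)) (eval-∸C b a)) (eval-+C _ _))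
        (eval-∸C 1 _)

tri : ℕ → ℕ
tri zero    = 0
tri (suc s) = suc s + tri s

tri-mono : ∀ {s t} → s ≤ t → tri s ≤ tri t
tri-mono {zero}          _         = z≤n
tri-mono {suc s} {suc t} (s≤s s≤t) = +-mono-≤ (s≤s s≤t) (tri-mono s≤t)

triC : Code 1
triC = cRec cZ (cComp +C (cComp cS (cP (# 0) ∷ []) ∷ cP (# 1) ∷ []))

eval-triC : ∀ s → Eval triC f (s ∷ []) (tri s)
eval-triC = eval-cRec tri eZ (λ s → eval₂ (eval₁ (eP (# 0)) eS) (eP (# 1)) (eval-+C (suc s) (tri s)))

pair : ℕ → ℕ → ℕ
pair n x = tri (n + x) + n

pairC : Code 2
pairC = cComp +C (cComp triC (+C ∷ []) ∷ cP (# 0) ∷ [])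

eval-pairC : ∀ n x → Eval pairC f (n ∷ x ∷ []) (pair n x)
eval-pairC n x = eval₂ (eval₁ (eval-+C n x) (eval-triC (n + x))) (eP (# 0)) (eval-+C _ n)

-- z lies on the diagonal s, i.e. tri s ≤ z < tri (suc s), iff s is the least zero of gap z.
gap : ℕ → ℕ → ℕ
gap z s = suc z ∸ tri (suc s)

diagonal-spec : ∀ z → Σ ℕ (IsLeastZero (gap z))
diagonal-spec z = leastZero (gap z) z (m≤n⇒m∸n≡0 (m≤m+n (suc z) (tri z)))

diagonal : ℕ → ℕ
diagonal = proj₁ ∘ diagonal-spec

pair-isLeastZero : ∀ n x → IsLeastZero (gap (pair n x)) (n + x)
pair-isLeastZero n x = m≤n⇒m∸n≡0 (s≤s pair≤) , above
  where
  pair≤ : tri (n + x) + n ≤ n + x + tri (n + x)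
  pair≤ = ≤-trans (≤-reflexive (+-comm (tri (n + x)) n)) (+-monoˡ-≤ (tri (n + x)) (m≤m+n n x))
  above : ∀ z → z < n + x → Σ ℕ λ d → gap (pair n x) z ≡ suc d
  above z z<n+x = pair n x ∸ tri (suc z) ,
                  +-∸-assoc 1 (≤-trans (tri-mono z<n+x) (m≤m+n (tri (n + x)) n))

diagonal-pair : ∀ n x → diagonal (pair n x) ≡ n + x
diagonal-pair n x = isLeastZero-unique (proj₂ (diagonal-spec (pair n x))) (pair-isLeastZero n x)

unpair₁ unpair₂ : ℕ → ℕ
unpair₁ z = z ∸ tri (diagonal z)
unpair₂ z = diagonal z ∸ unpair₁ z

unpair₁-pair : ∀ n x → unpair₁ (pair n x) ≡ n
unpair₁-pair n x = trans (cong (λ s → pair n x ∸ tri s) (diagonal-pair n x)) (m+n∸m≡n (tri (n + x)) n)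

unpair₂-pair : ∀ n x → unpair₂ (pair n x) ≡ x
unpair₂-pair n x = trans (cong₂ _∸_ (diagonal-pair n x) (unpair₁-pair n x)) (m+n∸m≡n n x)

diagonalC : Code 1
diagonalC = cMin (cComp ∸C (cComp cS (cP (# 1) ∷ []) ∷ cComp triC (cComp cS (cP (# 0) ∷ []) ∷ []) ∷ []))

eval-diagonalC : ∀ z → Eval diagonalC f (z ∷ []) (diagonal z)
eval-diagonalC z = eval-cMin eval-gap (proj₂ (diagonal-spec z))
  where
  eval-gap : ∀ s → Eval _ _ (s ∷ z ∷ []) (gap z s)
  eval-gap s = eval₂ (eval₁ (eP (# 1)) eS) (eval₁ (eval₁ (eP (# 0)) eS) (eval-triC (suc s))) (eval-∸C _ _)

unpair₁C unpair₂C : Code 1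
unpair₁C = cComp ∸C (cP (# 0) ∷ cComp triC (diagonalC ∷ []) ∷ [])
unpair₂C = cComp ∸C (diagonalC ∷ unpair₁C ∷ [])

eval-unpair₁C : ∀ z → Eval unpair₁C f (z ∷ []) (unpair₁ z)
eval-unpair₁C z = eval₂ (eP (# 0)) (eval₁ (eval-diagonalC z) (eval-triC _)) (eval-∸C _ _)

eval-unpair₂C : ∀ z → Eval unpair₂C f (z ∷ []) (unpair₂ z)
eval-unpair₂C z = eval₂ (eval-diagonalC z) (eval-unpair₁C z) (eval-∸C _ _)

tailC-⁀-computes : ∀ {m} (h : ℕ → ℕ) → tailC ⟦ m ⁀ h ⟧≡ (h 0 ⁀ (h ∘ suc))
tailC-⁀-computes h zero    = eval-tailC
tailC-⁀-computes h (suc u) = eval-tailC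

≤ω-refl : ∀ A → A ≤ω A
≤ω-refl A = tailC , λ n f f∈A → f , (λ x → eval-tailC) , f∈A

≤ω-trans : ∀ A B C → A ≤ω B → B ≤ω C → A ≤ω C
≤ω-trans A B C (Φ , Φ-reduces) (Ψ , Ψ-reduces) = withOracle (consC headC Ψ) Φ , reduce
  where
  reduce : ∀ n f → C n f → Σ (ℕ → ℕ) λ h → (withOracle (consC headC Ψ) Φ ⟦ n ⁀ f ⟧≡ h) × A n h
  reduce n f f∈C with Ψ-reduces n f f∈C
  ... | g , Ψ-computes , g∈B with Φ-reduces n g g∈B
  ...   | h , Φ-computes , h∈A =
    h , (λ x → eval-withOracle (consC-computes eval-headC Ψ-computes) (Φ-computes x)) , h∈A

module Adjoints (α : ℕ → ℕ) (α-computable : Computable α) where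

  αC : Code 1
  αC = withOracle cZ (proj₁ α-computable)

  eval-αC : ∀ n → Eval αC f (n ∷ []) (α n)
  eval-αC n = eval-withOracle (λ _ → eZ) (proj₂ α-computable n)

  prependα : Code 1 → Code 1
  prependα = consC (cComp αC (headC ∷ []))

  prependα-computes : ∀ {t : Code 1} {g : ℕ → ℕ} → t ⟦ f ⟧≡ g → prependα t ⟦ f ⟧≡ (α (f 0) ⁀ g)
  prependα-computes = consC-computes (eval₁ eval-headC (eval-αC _))

  ∃α : MassProblem → MassProblem
  ∃α Y m h = α (h 0) ≡ m × Y (h 0) (h ∘ suc)

  ∀α : MassProblem → MassProblem
  ∀α X m h = ∀ n → α n ≡ m → Σ (ℕ → ℕ) λ g → X n g × (∀ x → h (pair n x) ≡ g x)

  transpose-∃α : ∀ X Y → (α *) X ≤ω Y → X ≤ω ∃α Y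
  transpose-∃α X Y (Φ , Φ-reduces) = withOracle tailC Φ , reduce
    where
    reduce : ∀ m h → ∃α Y m h → Σ (ℕ → ℕ) λ g → (withOracle tailC Φ ⟦ m ⁀ h ⟧≡ g) × X m g
    reduce m h (αh0≡m , tail∈Y) with Φ-reduces (h 0) (h ∘ suc) tail∈Y
    ... | g , Φ-computes , g∈X =
      g , (λ x → eval-withOracle (tailC-⁀-computes h) (Φ-computes x)) , subst (λ i → X i g) αh0≡m g∈X

  untranspose-∃α : ∀ X Y → X ≤ω ∃α Y → (α *) X ≤ω Y
  untranspose-∃α X Y (Ψ , Ψ-reduces) = withOracle (prependα cO) Ψ , reduce
    where
    reduce : ∀ n f → Y n f → Σ (ℕ → ℕ) λ g → (withOracle (prependα cO) Ψ ⟦ n ⁀ f ⟧≡ g) × X (α n) g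
    reduce n f f∈Y with Ψ-reduces (α n) (n ⁀ f) (refl , f∈Y)
    ... | g , Ψ-computes , g∈X =
      g , (λ x → eval-withOracle (prependα-computes (λ _ → eO)) (Ψ-computes x)) , g∈X

  untranspose-∀α : ∀ X Y → ∀α X ≤ω Y → X ≤ω (α *) Y
  untranspose-∀α X Y (Ψ , Ψ-reduces) = Φ , reduce
    where
    Φ : Code 1
    Φ = cComp (withOracle (prependα tailC) Ψ) (cComp pairC (headC ∷ cP (# 0) ∷ []) ∷ [])
    reduce : ∀ n f → Y (α n) f → Σ (ℕ → ℕ) λ g → (Φ ⟦ n ⁀ f ⟧≡ g) × X n g
    reduce n f f∈Y with Ψ-reduces (α n) f f∈Y
    ... | h , Ψ-computes , h∈∀αX with h∈∀αX n refl
    ...   | g , g∈X , h-encodes-g = g , eval-Φ , g∈X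
      where
      eval-Φ : Φ ⟦ n ⁀ f ⟧≡ g
      eval-Φ x = eval₁ (eval₂ eval-headC (eP (# 0)) (eval-pairC n x))
                       (subst (Eval _ _ _) (h-encodes-g x)
                         (eval-withOracle (prependα-computes (λ _ → eval-tailC)) (Ψ-computes (pair n x))))

  sameIndexC : Code 1
  sameIndexC = cComp isEqC (cComp αC (unpair₁C ∷ []) ∷ headC ∷ [])

  eval-sameIndexC : ∀ {m f} z → Eval sameIndexC (m ⁀ f) (z ∷ []) (isEq (α (unpair₁ z)) m)
  eval-sameIndexC z = eval₂ (eval₁ (eval-unpair₁C z) (eval-αC _)) eval-headC (eval-isEqC _ _)

  -- On z = pair n x with α n = m, run Φ on n ⁀ f at x; elsewhere output 0.
  gatherC : Code 1 → Code 1
  gatherC Φ = guardC sameIndexC (cComp (relativize (consC unpair₁C tailC) Φ) (unpair₂C ∷ cP (# 0) ∷ []))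

  module Gather {X Y : MassProblem} {Φ : Code 1}
                (Φ-reduces : ∀ n f → Y (α n) f → Σ (ℕ → ℕ) λ g → (Φ ⟦ n ⁀ f ⟧≡ g) × X n g)
                {m : ℕ} {f : ℕ → ℕ} (f∈Y : Y m f) where

    witness : ∀ n → α n ≡ m → Σ (ℕ → ℕ) λ g → (Φ ⟦ n ⁀ f ⟧≡ g) × X n g
    witness n αn≡m = Φ-reduces n f (subst (λ i → Y i f) (sym αn≡m) f∈Y)

    witness-cong : ∀ {n n′} → n ≡ n′ → (e : α n ≡ m) (e′ : α n′ ≡ m) → ∀ {x x′} → x ≡ x′ →
                   proj₁ (witness n e) x ≡ proj₁ (witness n′ e′) x′
    witness-cong refl e e′ refl = cong (λ e → proj₁ (witness _ e) _) (≡-irrelevant e e′)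

    value : ∀ z → Dec (α (unpair₁ z) ≡ m) → ℕ
    value z (yes αn≡m) = proj₁ (witness (unpair₁ z) αn≡m) (unpair₂ z)
    value z (no _)     = 0

    gathered : ℕ → ℕ
    gathered z = value z (α (unpair₁ z) ≟ m)

    eval-value : ∀ z d → Eval (gatherC Φ) (m ⁀ f) (z ∷ []) (value z d)
    eval-value z (yes αn≡m) =
      eval-guardC-1 (subst (Eval _ _ _) (trans (cong (λ i → isEq i m) αn≡m) (isEq-refl m)) (eval-sameIndexC z))
        (eval₂ (eval-unpair₂C z) (eP (# 0))
          (eval-relativize (consC-computes (eval-unpair₁C z) (λ _ → eval-tailC))
                           (proj₁ (proj₂ (witness _ αn≡m)) (unpair₂ z))))
    eval-value z (no αn≢m) = eval-guardC-0 (subst (Eval _ _ _) (isEq-≢ αn≢m) (eval-sameIndexC z))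

    value-pair : ∀ n x (αn≡m : α n ≡ m) d → value (pair n x) d ≡ proj₁ (witness n αn≡m) x
    value-pair n x αn≡m (yes αn′≡m) = witness-cong (unpair₁-pair n x) αn′≡m αn≡m (unpair₂-pair n x)
    value-pair n x αn≡m (no αn′≢m)  = contradiction (subst (λ i → α i ≡ m) (sym (unpair₁-pair n x)) αn≡m) αn′≢m

    gatherC-computes : gatherC Φ ⟦ m ⁀ f ⟧≡ gathered
    gatherC-computes z = eval-value z (α (unpair₁ z) ≟ m)

    gathered∈∀αX : ∀α X m gathered
    gathered∈∀αX n αn≡m = proj₁ (witness n αn≡m) , proj₂ (proj₂ (witness n αn≡m)) ,
                          λ x → value-pair n x αn≡m (α (unpair₁ (pair n x)) ≟ m)

  transpose-∀α : ∀ X Y → X ≤ω (α *) Y → ∀α X ≤ω Y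
  transpose-∀α X Y (Φ , Φ-reduces) = gatherC Φ , λ m f f∈Y →
    let open Gather {X} {Y} Φ-reduces f∈Y in gathered , gatherC-computes , gathered∈∀αX

  ∃α-mono : ∀ X Y → X ≤ω Y → ∃α X ≤ω ∃α Y
  ∃α-mono X Y X≤Y = transpose-∃α (∃α X) Y (≤ω-trans _ X Y (untranspose-∃α (∃α X) X (≤ω-refl (∃α X))) X≤Y)

  ∀α-mono : ∀ X Y → X ≤ω Y → ∀α X ≤ω ∀α Y
  ∀α-mono X Y X≤Y = transpose-∀α X (∀α Y) (≤ω-trans X Y _ X≤Y (untranspose-∀α Y (∀α Y) (≤ω-refl (∀α Y))))

proposition4p3 : (α : ℕ → ℕ) → Computable α →
    Σ (MassProblem → MassProblem) (λ ∃α → Σ (MassProblem → MassProblem) (λ ∀α →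
      ((∀ X Y → X ≤ω Y → ∃α X ≤ω ∃α Y) × (∀ X Y → X ≤ω Y → ∀α X ≤ω ∀α Y)) ×
      ((∀ X Y → ((α *) X ≤ω Y → X ≤ω ∃α Y) × (X ≤ω ∃α Y → (α *) X ≤ω Y)) ×
       (∀ X Y → (X ≤ω (α *) Y → ∀α X ≤ω Y) × (∀α X ≤ω Y → X ≤ω (α *) Y)))))
proposition4p3 α α-computable =
  ∃α , ∀α , (∃α-mono , ∀α-mono) ,
  (λ X Y → transpose-∃α X Y , untranspose-∃α X Y) ,
  (λ X Y → transpose-∀α X Y , untranspose-∀α X Y)
  where open Adjoints α α-computable
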